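{- $r(C_4,B_{16})=27$ and $r(C_4,B_{18})=29$.
   Context: For graphs $H_1,H_2$, the Ramsey number $r(H_1,H_2)$ is the smallest integer $N$ such that for every graph $G$ on $N$ vertices, either $G$ contains $H_1$ as a subgraph or the complement $\overline{G}$ contains $H_2$ as a subgraph. $C_4$ denotes the cycle of length 4. For $n\ge 1$, the book $B_n$ is the graph consisting of $n$ triangles sharing a common edge. -}

module Defs where

open import Data.Nat using (ℕ; zero; suc; _+_; _<_; _%_; _≡ᵇ_)

open import Data.Fin using (Fin; zero; suc; toℕ; _≟_)
open import Data.Bool using (Bool; true; false; not; _∨_)
open import Data.Product using (Σ; ∃; _×_; _,_)
open import Data.Sum using (_⊎_)
open import Relation.Nullary using (¬_; yes; no)
open import Relation.Binary.PropositionalEquality using (_≡_; refl; sym)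
open import Function.Definitions using (Injective)

record Graph (n : ℕ) : Set where
  field
    adj     : Fin n → Fin n → Bool
    adj-sym : ∀ i j → adj i j ≡ adj j i
    adj-irr : ∀ i → adj i i ≡ false
open Graph public

compAdj : ∀ {n} → Graph n → Fin n → Fin n → Bool
compAdj G i j with i ≟ j
... | yes _ = false
... | no  _ = not (adj G i j)

compAdj-sym : ∀ {n} (G : Graph n) i j → compAdj G i j ≡ compAdj G j i
compAdj-sym G i j with i ≟ j | j ≟ i
... | yes _ | yes _ = refl
... | yes refl | no q = Data.Empty.⊥-elim (q refl) where import Data.Empty
... | no p | yes refl = Data.Empty.⊥-elim (p refl) where import Data.Empty
... | no _ | no _ rewrite adj-sym G i j = refl

compAdj-irr : ∀ {n} (G : Graph n) i → compAdj G i i ≡ false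
compAdj-irr G i with i ≟ i
... | yes _ = refl
... | no p = Data.Empty.⊥-elim (p refl) where import Data.Empty

complement : ∀ {n} → Graph n → Graph n
complement G = record { adj = compAdj G ; adj-sym = compAdj-sym G ; adj-irr = compAdj-irr G }

_⊆ᴳ_ : ∀ {k n} → Graph k → Graph n → Set
_⊆ᴳ_ {k} {n} H G =
  Σ (Fin k → Fin n) λ f →
    Injective _≡_ _≡_ f × (∀ a b → adj H a b ≡ true → adj G (f a) (f b) ≡ true)

RamseyProperty : ∀ {k l} → Graph k → Graph l → ℕ → Set
RamseyProperty H₁ H₂ N = (G : Graph N) → (H₁ ⊆ᴳ G) ⊎ (H₂ ⊆ᴳ complement G)

IsRamseyNumber : ∀ {k l} → Graph k → Graph l → ℕ → Set
IsRamseyNumber H₁ H₂ N = RamseyProperty H₁ H₂ N × (∀ M → M < N → ¬ RamseyProperty H₁ H₂ M)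

c4adj : Fin 4 → Fin 4 → Bool
c4adj i j = (((toℕ i + 1) % 4) ≡ᵇ toℕ j) ∨ (((toℕ j + 1) % 4) ≡ᵇ toℕ i)

C₄ : Graph 4
C₄ = record { adj = c4adj ; adj-sym = s ; adj-irr = r }
  where
  s : ∀ i j → c4adj i j ≡ c4adj j i
  s zero zero = refl
  s zero (suc zero) = refl
  s zero (suc (suc zero)) = refl
  s zero (suc (suc (suc zero))) = refl
  s (suc zero) zero = refl
  s (suc zero) (suc zero) = refl
  s (suc zero) (suc (suc zero)) = refl
  s (suc zero) (suc (suc (suc zero))) = refl
  s (suc (suc zero)) zero = refl
  s (suc (suc zero)) (suc zero) = refl
  s (suc (suc zero)) (suc (suc zero)) = refl
  s (suc (suc zero)) (suc (suc (suc zero))) = refl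
  s (suc (suc (suc zero))) zero = refl
  s (suc (suc (suc zero))) (suc zero) = refl
  s (suc (suc (suc zero))) (suc (suc zero)) = refl
  s (suc (suc (suc zero))) (suc (suc (suc zero))) = refl
  r : ∀ i → c4adj i i ≡ false
  r zero = refl
  r (suc zero) = refl
  r (suc (suc zero)) = refl
  r (suc (suc (suc zero))) = refl

-- The book B_n: vertices 0 and 1 form the common edge (spine); each of the
-- n further vertices is adjacent exactly to 0 and 1 (n triangles sharing edge 01).
bookAdj : ∀ n → Fin (2 + n) → Fin (2 + n) → Bool
bookAdj n zero zero = false
bookAdj n zero (suc _) = true
bookAdj n (suc zero) zero = true
bookAdj n (suc (suc _)) zero = true
bookAdj n (suc zero) (suc zero) = false
bookAdj n (suc zero) (suc (suc _)) = true
bookAdj n (suc (suc _)) (suc zero) = true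
bookAdj n (suc (suc _)) (suc (suc _)) = false

Book : (n : ℕ) → Graph (2 + n)
Book n = record { adj = bookAdj n ; adj-sym = s ; adj-irr = r }
  where
  s : ∀ i j → bookAdj n i j ≡ bookAdj n j i
  s zero zero = refl
  s zero (suc zero) = refl
  s zero (suc (suc _)) = refl
  s (suc zero) zero = refl
  s (suc (suc _)) zero = refl
  s (suc zero) (suc zero) = refl
  s (suc zero) (suc (suc _)) = refl
  s (suc (suc _)) (suc zero) = refl
  s (suc (suc _)) (suc (suc _)) = refl
  r : ∀ i → bookAdj n i i ≡ false
  r zero = refl
  r (suc zero) = refl
  r (suc (suc _)) = refl

-- Let G have N = n + 11 ≤ 31 vertices, no C₄ (two distinct vertices have at most
-- one common neighbour) and no B_n in its complement (two distinct non-adjacent vertices have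
-- fewer than n common non-neighbours).  Splitting the non-neighbourhood W of a vertex v by the
-- neighbours of a member x shows that x has at least 10 − deg v neighbours inside W.  Counting
-- cherries (paths a − x − b) gives Σₓ d_W(x)(d_W(x) − 1) ≤ |W|(|W| − 1) in a C₄-free graph, so
-- deg v ≤ 4 would force |W| > 30 ≥ N − 1; hence every degree is at least 5.  Inclusion–exclusion
-- shows that two non-adjacent vertices of degree 5 have no common neighbour, so counting cherries
-- once more, also inside the set S of degree-5 vertices, yields 120N + 3s(s − 1) ≤ 4N(N − 1) + 46s
-- for s = |S|; for N = 27 and N = 29 this fails for every s.
-- Lower bounds: explicit graphs on 26 and 28 vertices, checked by evaluation.
module Submission where

open import Data.Nat.Properties hiding (_≟_; suc-injective)
open import Algebra.Properties.Semiring.Sum +-*-semiring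
  using (sum; sum-syntax; sum-cong-≗; ∑-distrib-+; ∑-comm; *-distribˡ-sum; *-distribʳ-sum)
open import Data.Bool using (Bool; true; false; not; _∧_; T)
import Data.Bool.Properties as Bool
open import Data.Bool.ListAction using (any)
open import Data.Empty using (⊥; ⊥-elim)
open import Data.Fin using (Fin; zero; suc; _≟_; inject≤; toℕ)
open import Data.Fin.Patterns using (0F; 1F; 2F; 3F)
open import Data.Fin.Properties using (suc-injective; any?; all?; inject≤-injective)
open import Data.List using (List)
open import Data.Nat using (ℕ; zero; suc; _+_; _*_; _∸_; _≤_; _<_; z≤n; s≤s; s≤s⁻¹; _≤?_; _<?_; _≡ᵇ_)
open import Data.Nat.Tactic.RingSolver using (solve-∀)
open import Data.Product using (Σ; ∃-syntax; _×_; _,_; proj₁; proj₂)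
open import Data.Sum as Sum using (_⊎_; inj₁; inj₂)
open import Data.Vec using (Vec; lookup)
open import Function using (id; _∘_; case_of_)
open import Function.Definitions using (Injective)
open import Relation.Binary.PropositionalEquality
open import Relation.Nullary using (¬_; Dec; yes; no; does; ¬?)
open import Relation.Nullary.Decidable
  using (map′; _×-dec_; True; toWitness; from-yes; from-no; dec-false)

open import Defs

-- Counting with Boolean predicates

⟦_⟧ : Bool → ℕ
⟦ true ⟧  = 1
⟦ false ⟧ = 0

⟦∧⟧ : ∀ p q → ⟦ p ∧ q ⟧ ≡ ⟦ p ⟧ * ⟦ q ⟧
⟦∧⟧ true  q = sym (+-identityʳ ⟦ q ⟧)
⟦∧⟧ false q = refl

∧-true : ∀ {p q} → p ∧ q ≡ true → p ≡ true × q ≡ true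
∧-true {true} {true} _ = refl , refl

count : ∀ {n} → (Fin n → Bool) → ℕ
count {n} P = ∑[ i < n ] ⟦ P i ⟧

_∩_ : ∀ {n} → (Fin n → Bool) → (Fin n → Bool) → (Fin n → Bool)
(P ∩ Q) x = P x ∧ Q x

_∖_ : ∀ {n} → (Fin n → Bool) → Fin n → (Fin n → Bool)
(P ∖ a) x = P x ∧ not (does (a ≟ x))

∖-true : ∀ {n} (P : Fin n → Bool) a {y} → (P ∖ a) y ≡ true → P y ≡ true × a ≢ y
∖-true P a {y} h with P y | a ≟ y | h
... | true  | no a≢y | _ = refl , a≢y
... | false | _      | ()
... | true  | yes _  | ()

∑-mono-≤ : ∀ {n} {f g : Fin n → ℕ} → (∀ i → f i ≤ g i) → sum f ≤ sum g
∑-mono-≤ {zero}  f≤g = z≤n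
∑-mono-≤ {suc n} f≤g = +-mono-≤ (f≤g zero) (∑-mono-≤ (f≤g ∘ suc))

∑-const : ∀ n k → ∑[ i < n ] k ≡ n * k
∑-const zero    k = refl
∑-const (suc n) k = cong (k +_) (∑-const n k)

∑-distrib-+₃ : ∀ {n} (f g h : Fin n → ℕ) → ∑[ i < n ] (f i + g i + h i) ≡ sum f + sum g + sum h
∑-distrib-+₃ f g h = trans (∑-distrib-+ (λ i → f i + g i) h) (cong (_+ sum h) (∑-distrib-+ f g))

∑∑-distrib-+ : ∀ {m n} (f g : Fin m → Fin n → ℕ) →
  ∑[ a < m ] ∑[ b < n ] (f a b + g a b) ≡ ∑[ a < m ] ∑[ b < n ] f a b + ∑[ a < m ] ∑[ b < n ] g a b
∑∑-distrib-+ f g = trans (sum-cong-≗ (λ a → ∑-distrib-+ (f a) (g a))) (∑-distrib-+ (λ a → sum (f a)) _)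

∑-⟦⟧* : ∀ {n} (P : Fin n → Bool) k → ∑[ a < n ] (⟦ P a ⟧ * k) ≡ count P * k
∑-⟦⟧* P k = sym (*-distribʳ-sum k (λ a → ⟦ P a ⟧))

count-true : ∀ n → count {n} (λ _ → true) ≡ n
count-true n = trans (∑-const n 1) (*-identityʳ n)

count-≤ : ∀ {n} (P : Fin n → Bool) → count P ≤ n
count-≤ {n} P = subst (count P ≤_) (count-true n) (∑-mono-≤ (⟦⟧≤1 ∘ P))
  where
  ⟦⟧≤1 : ∀ b → ⟦ b ⟧ ≤ 1
  ⟦⟧≤1 true  = ≤-refl
  ⟦⟧≤1 false = z≤n

count-∩-comm : ∀ {n} (P Q : Fin n → Bool) → count (P ∩ Q) ≡ count (Q ∩ P)
count-∩-comm P Q = sum-cong-≗ (λ x → cong ⟦_⟧ (Bool.∧-comm (P x) (Q x)))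

count-singleton : ∀ {n} (a : Fin n) → count (λ x → does (a ≟ x)) ≡ 1
count-singleton {suc n} zero    = cong suc (trans (∑-const n 0) (*-zeroʳ n))
count-singleton {suc n} (suc a) = trans (sum-cong-≗ (cong ⟦_⟧ ∘ ≟-suc)) (count-singleton a)
  where
  ≟-suc : ∀ x → does (suc a ≟ suc x) ≡ does (a ≟ x)
  ≟-suc x with a ≟ x
  ... | yes _ = refl
  ... | no  _ = refl

count-∩-singleton : ∀ {n} (W : Fin n → Bool) x → count (W ∩ (λ y → does (x ≟ y))) ≡ ⟦ W x ⟧
count-∩-singleton {n} W x = begin
  count (W ∩ (λ y → does (x ≟ y)))        ≡⟨ sum-cong-≗ pointwise ⟩
  ∑[ y < n ] (⟦ W x ⟧ * ⟦ does (x ≟ y) ⟧)  ≡⟨ *-distribˡ-sum ⟦ W x ⟧ (λ y → ⟦ does (x ≟ y) ⟧) ⟨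
  ⟦ W x ⟧ * count (λ y → does (x ≟ y))    ≡⟨ cong (⟦ W x ⟧ *_) (count-singleton x) ⟩
  ⟦ W x ⟧ * 1                             ≡⟨ *-identityʳ _ ⟩
  ⟦ W x ⟧                                 ∎
  where
  open ≡-Reasoning
  pointwise : ∀ y → ⟦ W y ∧ does (x ≟ y) ⟧ ≡ ⟦ W x ⟧ * ⟦ does (x ≟ y) ⟧
  pointwise y with x ≟ y
  ... | yes refl = ⟦∧⟧ (W x) true
  ... | no  _    = trans (⟦∧⟧ (W y) false) (trans (*-zeroʳ ⟦ W y ⟧) (sym (*-zeroʳ ⟦ W x ⟧)))

count-remove : ∀ {n} (P : Fin n → Bool) {a} → P a ≡ true → count P ≡ suc (count (P ∖ a))
count-remove {n} P {a} Pa = begin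
  count P                                        ≡⟨ sum-cong-≗ split ⟩
  ∑[ x < n ] (⟦ (P ∖ a) x ⟧ + ⟦ does (a ≟ x) ⟧)  ≡⟨ ∑-distrib-+ (λ x → ⟦ (P ∖ a) x ⟧) _ ⟩
  count (P ∖ a) + count (λ x → does (a ≟ x))     ≡⟨ cong (count (P ∖ a) +_) (count-singleton a) ⟩
  count (P ∖ a) + 1                              ≡⟨ +-comm _ 1 ⟩
  suc (count (P ∖ a))                            ∎
  where
  open ≡-Reasoning
  split : ∀ x → ⟦ P x ⟧ ≡ ⟦ (P ∖ a) x ⟧ + ⟦ does (a ≟ x) ⟧
  split x with a ≟ x
  ... | yes refl rewrite Pa = refl
  ... | no  _    with P x
  ...   | true  = refl
  ...   | false = refl

orderedPairs : ∀ {n} (P : Fin n → Bool) →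
  ∑[ a < n ] ∑[ b < n ] ⟦ P a ∧ (P ∖ a) b ⟧ ≡ count P * (count P ∸ 1)
orderedPairs {n} P = trans (sum-cong-≗ row) (∑-⟦⟧* P (count P ∸ 1))
  where
  open ≡-Reasoning
  others : ∀ a → ⟦ P a ⟧ * count (P ∖ a) ≡ ⟦ P a ⟧ * (count P ∸ 1)
  others a with P a in Pa
  ... | true  = cong (1 *_) (cong (_∸ 1) (sym (count-remove P Pa)))
  ... | false = refl
  row : ∀ a → ∑[ b < n ] ⟦ P a ∧ (P ∖ a) b ⟧ ≡ ⟦ P a ⟧ * (count P ∸ 1)
  row a = begin
    ∑[ b < n ] ⟦ P a ∧ (P ∖ a) b ⟧        ≡⟨ sum-cong-≗ (λ b → ⟦∧⟧ (P a) ((P ∖ a) b)) ⟩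
    ∑[ b < n ] (⟦ P a ⟧ * ⟦ (P ∖ a) b ⟧)  ≡⟨ *-distribˡ-sum ⟦ P a ⟧ (λ b → ⟦ (P ∖ a) b ⟧) ⟨
    ⟦ P a ⟧ * count (P ∖ a)               ≡⟨ others a ⟩
    ⟦ P a ⟧ * (count P ∸ 1)               ∎

0<count⇒∃ : ∀ {n} (P : Fin n → Bool) → 0 < count P → ∃[ a ] P a ≡ true
0<count⇒∃ {suc n} P pos with P zero in P0
... | true  = zero , P0
... | false = let a , Pa = 0<count⇒∃ (P ∘ suc) pos in suc a , Pa

injection⇒≤count : ∀ {k n} (P : Fin n → Bool) (f : Fin k → Fin n) →
  Injective _≡_ _≡_ f → (∀ i → P (f i) ≡ true) → k ≤ count P
injection⇒≤count {zero}  P f f-inj f∈P = z≤n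
injection⇒≤count {suc k} P f f-inj f∈P = subst (suc k ≤_) (sym (count-remove P (f∈P zero)))
  (s≤s (injection⇒≤count (P ∖ f zero) (f ∘ suc) (suc-injective ∘ f-inj) tail∈P∖f₀))
  where
  tail∈P∖f₀ : ∀ i → (P ∖ f zero) (f (suc i)) ≡ true
  tail∈P∖f₀ i rewrite f∈P (suc i) | dec-false (f zero ≟ f (suc i)) ((λ ()) ∘ f-inj) = refl

module _ where
  open import Data.Vec.Functional using ([]; _∷_)

  injective-∷ : ∀ {A : Set} {k} {a : A} {g : Fin k → A} →
    (∀ i → a ≢ g i) → Injective _≡_ _≡_ g → Injective _≡_ _≡_ (a ∷ g)
  injective-∷ a∉g g-inj {zero}  {zero}  _ = refl
  injective-∷ a∉g g-inj {zero}  {suc j} e = ⊥-elim (a∉g j e)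
  injective-∷ a∉g g-inj {suc i} {zero}  e = ⊥-elim (a∉g i (sym e))
  injective-∷ a∉g g-inj {suc i} {suc j} e = cong suc (g-inj e)

  ≤count⇒injection : ∀ {k n} (P : Fin n → Bool) → k ≤ count P →
    Σ (Fin k → Fin n) λ f → Injective _≡_ _≡_ f × (∀ i → P (f i) ≡ true)
  ≤count⇒injection {zero}  P _ = [] , (λ { {()} }) , λ ()
  ≤count⇒injection {suc k} P suc-k≤count with 0<count⇒∃ P (≤-trans (s≤s z≤n) suc-k≤count)
  ... | a , Pa with ≤count⇒injection (P ∖ a) (s≤s⁻¹ (subst (suc k ≤_) (count-remove P Pa) suc-k≤count))
  ...   | g , g-inj , g∈P∖a = a ∷ g , injective-∷ (proj₂ ∘ ∖-true P a ∘ g∈P∖a) g-inj , a∷g∈P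
    where
    a∷g∈P : ∀ i → P ((a ∷ g) i) ≡ true
    a∷g∈P zero    = Pa
    a∷g∈P (suc i) = proj₁ (∖-true P a (g∈P∖a i))

-- Degrees, codegrees and cherries

module _ {N : ℕ} (G : Graph N) where

  deg : Fin N → ℕ
  deg x = count (adj G x)

  degIn : (Fin N → Bool) → Fin N → ℕ
  degIn W x = count (W ∩ adj G x)

  codeg : Fin N → Fin N → ℕ
  codeg a b = count (adj G a ∩ adj G b)

  adj⇒≢ : ∀ {a b} → adj G a b ≡ true → a ≢ b
  adj⇒≢ {a} ab refl = case trans (sym ab) (adj-irr G a) of λ ()

  adj-sym-true : ∀ {a b} → adj G a b ≡ true → adj G b a ≡ true
  adj-sym-true {a} {b} ab = trans (adj-sym G b a) ab

  compAdj⇒¬adj : ∀ {a b} → compAdj G a b ≡ true → adj G a b ≡ false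
  compAdj⇒¬adj {a} {b} h with a ≟ b | h
  ... | no _ | ¬ab = Bool.not-injective ¬ab

  trichotomy : ∀ x y → ⟦ compAdj G x y ⟧ + ⟦ adj G x y ⟧ + ⟦ does (x ≟ y) ⟧ ≡ 1
  trichotomy x y with x ≟ y
  ... | yes refl rewrite adj-irr G x = refl
  ... | no _     with adj G x y
  ...   | true  = refl
  ...   | false = refl

  count-split : ∀ (W : Fin N → Bool) x →
    count W ≡ count (W ∩ compAdj G x) + count (W ∩ adj G x) + ⟦ W x ⟧
  count-split W x = begin
    count W
      ≡⟨ sum-cong-≗ split ⟩
    ∑[ y < N ] (⟦ (W ∩ compAdj G x) y ⟧ + ⟦ (W ∩ adj G x) y ⟧ + ⟦ (W ∩ (λ y → does (x ≟ y))) y ⟧)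
      ≡⟨ ∑-distrib-+₃ (λ y → ⟦ (W ∩ compAdj G x) y ⟧) (λ y → ⟦ (W ∩ adj G x) y ⟧) _ ⟩
    count (W ∩ compAdj G x) + count (W ∩ adj G x) + count (W ∩ (λ y → does (x ≟ y)))
      ≡⟨ cong (count (W ∩ compAdj G x) + count (W ∩ adj G x) +_) (count-∩-singleton W x) ⟩
    count (W ∩ compAdj G x) + count (W ∩ adj G x) + ⟦ W x ⟧ ∎
    where
    open ≡-Reasoning
    split : ∀ y →
      ⟦ W y ⟧ ≡ ⟦ (W ∩ compAdj G x) y ⟧ + ⟦ (W ∩ adj G x) y ⟧ + ⟦ (W ∩ (λ y → does (x ≟ y))) y ⟧
    split y with W y
    ... | true  = sym (trichotomy x y)
    ... | false = refl

module _ {N : ℕ} (G : Graph N) where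
  open import Algebra.Solver.CommutativeMonoid Bool.∧-commutativeMonoid using (solve; _⊕_; _⊜_)

  deg-complement : ∀ v → deg (complement G) v + deg G v + 1 ≡ N
  deg-complement v = trans (sym (count-split G (λ _ → true) v)) (count-true N)

  codeg-complement : ∀ {a b} → compAdj G a b ≡ true →
    codeg (complement G) a b + deg G a + deg G b + 2 ≡ N + codeg G a b
  codeg-complement {a} {b} a≁b = begin
    c̄ + deg G a + deg G b + 2                         ≡⟨ cong (λ t → c̄ + deg G a + t + 2) deg-b ⟩
    c̄ + deg G a + (K + codeg G a b) + 2               ≡⟨ rearrange c̄ K (deg G a) (codeg G a b) ⟩
    c̄ + K + 1 + deg G a + 1 + codeg G a b             ≡⟨ cong (λ t → t + deg G a + 1 + codeg G a b) deg̅-a ⟨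
    deg (complement G) a + deg G a + 1 + codeg G a b  ≡⟨ cong (_+ codeg G a b) (deg-complement a) ⟩
    N + codeg G a b                                   ∎
    where
    open ≡-Reasoning
    c̄ : ℕ
    c̄ = codeg (complement G) a b
    K : ℕ
    K = count (adj G b ∩ compAdj G a)
    deg̅-a : deg (complement G) a ≡ c̄ + K + 1
    deg̅-a = begin
      deg (complement G) a                               ≡⟨ count-split G (compAdj G a) b ⟩
      c̄ + count (compAdj G a ∩ adj G b) + ⟦ compAdj G a b ⟧
        ≡⟨ cong₂ (λ k e → c̄ + k + ⟦ e ⟧) (count-∩-comm (compAdj G a) (adj G b)) a≁b ⟩
      c̄ + K + 1                                          ∎
    b≁a : adj G b a ≡ false
    b≁a = trans (adj-sym G b a) (compAdj⇒¬adj G a≁b)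
    deg-b : deg G b ≡ K + codeg G a b
    deg-b = begin
      deg G b                          ≡⟨ count-split G (adj G b) a ⟩
      K + codeg G b a + ⟦ adj G b a ⟧  ≡⟨ cong (λ e → K + codeg G b a + ⟦ e ⟧) b≁a ⟩
      K + codeg G b a + 0              ≡⟨ +-identityʳ _ ⟩
      K + codeg G b a                  ≡⟨ cong (K +_) (count-∩-comm (adj G b) (adj G a)) ⟩
      K + codeg G a b                  ∎
    rearrange : ∀ c k d e → c + d + (k + e) + 2 ≡ c + k + 1 + d + 1 + e
    rearrange = solve-∀

  cherries : ∀ (W : Fin N → Bool) →
    ∑[ x < N ] (degIn G W x * (degIn G W x ∸ 1))
      ≡ ∑[ a < N ] ∑[ b < N ] (⟦ W a ∧ (W ∖ a) b ⟧ * codeg G a b)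
  cherries W = begin
    ∑[ x < N ] (degIn G W x * (degIn G W x ∸ 1))
      ≡⟨ sum-cong-≗ (λ x → sym (orderedPairs (W ∩ adj G x))) ⟩
    ∑[ x < N ] ∑[ a < N ] ∑[ b < N ] ⟦ (W ∩ adj G x) a ∧ ((W ∩ adj G x) ∖ a) b ⟧
      ≡⟨ sum-cong-≗ (λ x → sum-cong-≗ (λ a → sum-cong-≗ (λ b → regroup x a b))) ⟩
    ∑[ x < N ] ∑[ a < N ] ∑[ b < N ] (⟦ W a ∧ (W ∖ a) b ⟧ * ⟦ (adj G a ∩ adj G b) x ⟧)
      ≡⟨ ∑-comm (λ x a → ∑[ b < N ] (⟦ W a ∧ (W ∖ a) b ⟧ * ⟦ (adj G a ∩ adj G b) x ⟧)) ⟩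
    ∑[ a < N ] ∑[ x < N ] ∑[ b < N ] (⟦ W a ∧ (W ∖ a) b ⟧ * ⟦ (adj G a ∩ adj G b) x ⟧)
      ≡⟨ sum-cong-≗ (λ a → ∑-comm (λ x b → ⟦ W a ∧ (W ∖ a) b ⟧ * ⟦ (adj G a ∩ adj G b) x ⟧)) ⟩
    ∑[ a < N ] ∑[ b < N ] ∑[ x < N ] (⟦ W a ∧ (W ∖ a) b ⟧ * ⟦ (adj G a ∩ adj G b) x ⟧)
      ≡⟨ sum-cong-≗ (λ a → sum-cong-≗ (λ b →
           *-distribˡ-sum ⟦ W a ∧ (W ∖ a) b ⟧ (λ x → ⟦ (adj G a ∩ adj G b) x ⟧))) ⟨
    ∑[ a < N ] ∑[ b < N ] (⟦ W a ∧ (W ∖ a) b ⟧ * codeg G a b) ∎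
    where
    open ≡-Reasoning
    regroup : ∀ x a b →
      ⟦ (W ∩ adj G x) a ∧ ((W ∩ adj G x) ∖ a) b ⟧
        ≡ ⟦ W a ∧ (W ∖ a) b ⟧ * ⟦ (adj G a ∩ adj G b) x ⟧
    regroup x a b rewrite adj-sym G a x | adj-sym G b x =
      trans (cong ⟦_⟧ (solve 5 (λ wa p wb q e → (wa ⊕ p) ⊕ ((wb ⊕ q) ⊕ e) ⊜ (wa ⊕ (wb ⊕ e)) ⊕ (p ⊕ q)) refl
                                 (W a) (adj G x a) (W b) (adj G x b) (not (does (a ≟ b)))))
            (⟦∧⟧ (W a ∧ (W ∖ a) b) _)

  cherries+R≤pairs : (R : Fin N → Fin N → Bool) → (∀ a b → a ≢ b → codeg G a b + ⟦ R a b ⟧ ≤ 1) →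
    ∀ W → ∑[ x < N ] (degIn G W x * (degIn G W x ∸ 1))
            + ∑[ a < N ] ∑[ b < N ] (⟦ W a ∧ (W ∖ a) b ⟧ * ⟦ R a b ⟧)
          ≤ count W * (count W ∸ 1)
  cherries+R≤pairs R codeg+R≤1 W = begin
    ∑[ x < N ] (degIn G W x * (degIn G W x ∸ 1)) + marked
      ≡⟨ cong (_+ marked) (cherries W) ⟩
    ∑[ a < N ] ∑[ b < N ] (pair a b * codeg G a b) + marked
      ≡⟨ ∑∑-distrib-+ (λ a b → pair a b * codeg G a b) (λ a b → pair a b * ⟦ R a b ⟧) ⟨
    ∑[ a < N ] ∑[ b < N ] (pair a b * codeg G a b + pair a b * ⟦ R a b ⟧)
      ≤⟨ ∑-mono-≤ (λ a → ∑-mono-≤ (pointwise a)) ⟩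
    ∑[ a < N ] ∑[ b < N ] pair a b
      ≡⟨ orderedPairs W ⟩
    count W * (count W ∸ 1) ∎
    where
    open ≤-Reasoning
    pair : Fin N → Fin N → ℕ
    pair a b = ⟦ W a ∧ (W ∖ a) b ⟧
    marked : ℕ
    marked = ∑[ a < N ] ∑[ b < N ] (pair a b * ⟦ R a b ⟧)
    pointwise : ∀ a b → pair a b * codeg G a b + pair a b * ⟦ R a b ⟧ ≤ pair a b
    pointwise a b with W a ∧ (W ∖ a) b in a,b∈W
    ... | false = z≤n
    ... | true rewrite *-identityˡ (codeg G a b) | *-identityˡ ⟦ R a b ⟧ =
      codeg+R≤1 a b (proj₂ (∖-true W a (proj₂ (∧-true {W a} a,b∈W))))

  cherries≤pairs : (∀ a b → a ≢ b → codeg G a b ≤ 1) →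
    ∀ W → ∑[ x < N ] (degIn G W x * (degIn G W x ∸ 1)) ≤ count W * (count W ∸ 1)
  cherries≤pairs codeg≤1 W = m+n≤o⇒m≤o _ (cherries+R≤pairs (λ _ _ → false) codeg+0≤1 W)
    where
    codeg+0≤1 : ∀ a b → a ≢ b → codeg G a b + 0 ≤ 1
    codeg+0≤1 a b a≢b = subst (_≤ 1) (sym (+-identityʳ _)) (codeg≤1 a b a≢b)

-- C₄ and books as subgraphs

module _ {N : ℕ} (G : Graph N) where
  open import Data.Vec.Functional using ([]; _∷_)

  C₄⊆ᴳ⇒codeg≥2 : C₄ ⊆ᴳ G → ∃[ a ] ∃[ b ] a ≢ b × 2 ≤ codeg G a b
  C₄⊆ᴳ⇒codeg≥2 (f , f-inj , e) =
    f 0F , f 2F , (λ ()) ∘ f-inj ,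
    injection⇒≤count (adj G (f 0F) ∩ adj G (f 2F)) (f 1F ∷ f 3F ∷ []) g-inj common
    where
    g-inj : Injective _≡_ _≡_ (f 1F ∷ f 3F ∷ [])
    g-inj = injective-∷ (λ { 0F → (λ ()) ∘ f-inj }) (λ { {0F} {0F} _ → refl })
    common : ∀ i → (adj G (f 0F) ∩ adj G (f 2F)) ((f 1F ∷ f 3F ∷ []) i) ≡ true
    common 0F rewrite e 0F 1F refl | e 2F 1F refl = refl
    common 1F rewrite e 0F 3F refl | e 2F 3F refl = refl

  codeg≥2⇒C₄⊆ᴳ : (∃[ a ] ∃[ b ] a ≢ b × 2 ≤ codeg G a b) → C₄ ⊆ᴳ G
  codeg≥2⇒C₄⊆ᴳ (a , b , a≢b , 2≤codeg) with ≤count⇒injection (adj G a ∩ adj G b) 2≤codeg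
  ... | g , g-inj , common = f , f-inj , edges
    where
    x y : Fin N
    x = g 0F
    y = g 1F
    ax : adj G a x ≡ true
    ax = proj₁ (∧-true (common 0F))
    bx : adj G b x ≡ true
    bx = proj₂ (∧-true (common 0F))
    ay : adj G a y ≡ true
    ay = proj₁ (∧-true (common 1F))
    by : adj G b y ≡ true
    by = proj₂ (∧-true (common 1F))
    f : Fin 4 → Fin N
    f = a ∷ x ∷ b ∷ y ∷ []
    f-inj : Injective _≡_ _≡_ f
    f-inj = injective-∷ (λ { 0F → adj⇒≢ G ax ; 1F → a≢b ; 2F → adj⇒≢ G ay })
           (injective-∷ (λ { 0F → adj⇒≢ G bx ∘ sym ; 1F → (λ ()) ∘ g-inj })
           (injective-∷ (λ { 0F → adj⇒≢ G by })
           (λ { {0F} {0F} _ → refl })))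
    edges : ∀ i j → adj C₄ i j ≡ true → adj G (f i) (f j) ≡ true
    edges 0F 1F _ = ax
    edges 0F 3F _ = ay
    edges 1F 0F _ = adj-sym-true G ax
    edges 1F 2F _ = adj-sym-true G bx
    edges 2F 1F _ = bx
    edges 2F 3F _ = by
    edges 3F 0F _ = adj-sym-true G ay
    edges 3F 2F _ = adj-sym-true G by
    edges 0F 0F ()
    edges 0F 2F ()
    edges 1F 1F ()
    edges 1F 3F ()
    edges 2F 0F ()
    edges 2F 2F ()
    edges 3F 1F ()
    edges 3F 3F ()

  Book⊆ᴳ⇒codeg≥ : ∀ {n} → Book n ⊆ᴳ G → ∃[ u ] ∃[ v ] adj G u v ≡ true × n ≤ codeg G u v
  Book⊆ᴳ⇒codeg≥ (f , f-inj , e) =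
    f 0F , f 1F , e 0F 1F refl ,
    injection⇒≤count (adj G (f 0F) ∩ adj G (f 1F)) (λ i → f (suc (suc i)))
                     (suc-injective ∘ suc-injective ∘ f-inj) common
    where
    common : ∀ i → (adj G (f 0F) ∩ adj G (f 1F)) (f (suc (suc i))) ≡ true
    common i rewrite e 0F (suc (suc i)) refl | e 1F (suc (suc i)) refl = refl

  codeg≥⇒Book⊆ᴳ : ∀ {n} → (∃[ u ] ∃[ v ] adj G u v ≡ true × n ≤ codeg G u v) → Book n ⊆ᴳ G
  codeg≥⇒Book⊆ᴳ {n} (u , v , uv , n≤codeg) with ≤count⇒injection (adj G u ∩ adj G v) n≤codeg
  ... | g , g-inj , common = f , f-inj , edges
    where
    ug : ∀ i → adj G u (g i) ≡ true
    ug = proj₁ ∘ ∧-true ∘ common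
    vg : ∀ i → adj G v (g i) ≡ true
    vg = proj₂ ∘ ∧-true ∘ common
    f : Fin (2 + n) → Fin N
    f = u ∷ v ∷ g
    f-inj : Injective _≡_ _≡_ f
    f-inj = injective-∷ (λ { zero → adj⇒≢ G uv ; (suc i) → adj⇒≢ G (ug i) })
           (injective-∷ (adj⇒≢ G ∘ vg) g-inj)
    edges : ∀ i j → adj (Book n) i j ≡ true → adj G (f i) (f j) ≡ true
    edges 0F            1F            _ = uv
    edges 0F            (suc (suc j)) _ = ug j
    edges 1F            0F            _ = adj-sym-true G uv
    edges 1F            (suc (suc j)) _ = vg j
    edges (suc (suc i)) 0F            _ = adj-sym-true G (ug i)
    edges (suc (suc i)) 1F            _ = adj-sym-true G (vg i)
    edges 0F            0F            ()
    edges 1F            1F            ()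
    edges (suc (suc i)) (suc (suc j)) ()

  C₄⊆ᴳ? : Dec (C₄ ⊆ᴳ G)
  C₄⊆ᴳ? = map′ codeg≥2⇒C₄⊆ᴳ C₄⊆ᴳ⇒codeg≥2
    (any? λ a → any? λ b → ¬? (a ≟ b) ×-dec (2 ≤? codeg G a b))

  Book⊆ᴳ? : ∀ n → Dec (Book n ⊆ᴳ G)
  Book⊆ᴳ? n = map′ codeg≥⇒Book⊆ᴳ Book⊆ᴳ⇒codeg≥
    (any? λ u → any? λ v → (adj G u v Bool.≟ true) ×-dec (n ≤? codeg G u v))

-- The upper bound

4*d≤d*[d∸1]+6 : ∀ d → 4 * d ≤ d * (d ∸ 1) + 6
4*d≤d*[d∸1]+6 0 = z≤n
4*d≤d*[d∸1]+6 1 = s≤s (s≤s (s≤s (s≤s z≤n)))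
4*d≤d*[d∸1]+6 2 = ≤-refl
4*d≤d*[d∸1]+6 3 = ≤-refl
4*d≤d*[d∸1]+6 (suc (suc (suc (suc d)))) = begin
  4 * (4 + d)                       ≡⟨ expand-left d ⟩
  16 + 4 * d                        ≤⟨ m≤m+n (16 + 4 * d) (d * d + 3 * d + 2) ⟩
  16 + 4 * d + (d * d + 3 * d + 2)  ≡⟨ expand-right d ⟩
  (4 + d) * (3 + d) + 6             ∎
  where
  open ≤-Reasoning
  expand-left : ∀ d → 4 * (4 + d) ≡ 16 + 4 * d
  expand-left = solve-∀
  expand-right : ∀ d → 16 + 4 * d + (d * d + 3 * d + 2) ≡ (4 + d) * (3 + d) + 6
  expand-right = solve-∀

6≤d⇒30≤d*[d∸1] : ∀ {d} → 6 ≤ d → 30 ≤ d * (d ∸ 1)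
6≤d⇒30≤d*[d∸1] 6≤d = *-mono-≤ 6≤d (∸-monoˡ-≤ 1 6≤d)

5≤d⇒30≤d*[d∸1]+10*[d≡5] : ∀ {d} → 5 ≤ d → 30 ≤ d * (d ∸ 1) + 10 * ⟦ d ≡ᵇ 5 ⟧
5≤d⇒30≤d*[d∸1]+10*[d≡5] 5≤d with m≤n⇒m<n∨m≡n 5≤d
... | inj₂ refl = ≤-refl
... | inj₁ 6≤d  = ≤-trans (6≤d⇒30≤d*[d∸1] 6≤d) (m≤m+n _ _)

w*30≰w*[w∸1] : ∀ {w} → 0 < w → w ≤ 30 → ¬ w * 30 ≤ w * (w ∸ 1)
w*30≰w*[w∸1] {suc w} _ w<30 = <⇒≱ w<30 ∘ *-cancelˡ-≤ (suc w)

counting-inequality : ∀ {N s Y X D Q c M} →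
  30 * N ≤ Y + 10 * s → Y + X ≤ M → X + D ≡ c → 4 * D ≤ Q + 6 * s → Q ≤ c →
  120 * N + 3 * c ≤ 4 * M + 46 * s
counting-inequality {N} {s} {Y} {X} {D} {Q} {c} {M} 30N≤ Y+X≤M refl 4D≤ Q≤c =
  +-cancelʳ-≤ c (120 * N + 3 * c) (4 * M + 46 * s) (begin
    120 * N + 3 * c + c               ≡⟨ expand N X D ⟩
    4 * (30 * N) + 4 * X + 4 * D      ≤⟨ +-monoˡ-≤ (4 * D) (+-monoˡ-≤ (4 * X) (*-monoʳ-≤ 4 30N≤)) ⟩
    4 * (Y + 10 * s) + 4 * X + 4 * D  ≡⟨ regroup Y X s D ⟩
    4 * (Y + X) + 40 * s + 4 * D      ≤⟨ +-mono-≤ (+-monoˡ-≤ (40 * s) (*-monoʳ-≤ 4 Y+X≤M)) 4D≤ ⟩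
    4 * M + 40 * s + (Q + 6 * s)      ≤⟨ +-monoʳ-≤ (4 * M + 40 * s) (+-monoˡ-≤ (6 * s) Q≤c) ⟩
    4 * M + 40 * s + (c + 6 * s)      ≡⟨ collect M s c ⟩
    4 * M + 46 * s + c                ∎)
  where
  open ≤-Reasoning
  expand : ∀ N X D → 120 * N + 3 * (X + D) + (X + D) ≡ 4 * (30 * N) + 4 * X + 4 * D
  expand = solve-∀
  regroup : ∀ Y X s D → 4 * (Y + 10 * s) + 4 * X + 4 * D ≡ 4 * (Y + X) + 40 * s + 4 * D
  regroup = solve-∀
  collect : ∀ M s c → 4 * M + 40 * s + (c + 6 * s) ≡ 4 * M + 46 * s + c
  collect = solve-∀

CountingInequalityFails : ℕ → Set
CountingInequalityFails N =
  ∀ {s} → s < suc N → 4 * (N * (N ∸ 1)) + 46 * s < 120 * N + 3 * (s * (s ∸ 1))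

countingInequalityFails? : ∀ N → Dec (CountingInequalityFails N)
countingInequalityFails? N =
  allUpTo? (λ s → 4 * (N * (N ∸ 1)) + 46 * s <? 120 * N + 3 * (s * (s ∸ 1))) (suc N)

module UpperBound {n : ℕ} (G : Graph (11 + n))
  (codeg≤1 : ∀ a b → a ≢ b → codeg G a b ≤ 1)
  (codeg̅<n : ∀ u v → compAdj G u v ≡ true → codeg (complement G) u v < n)
  where

  private
    N : ℕ
    N = 11 + n

  minDegree : n ≤ 20 → ∀ v → 5 ≤ deg G v
  minDegree n≤20 v = ≮⇒≥ (λ deg<5 → lowDegree⇒⊥ (s≤s⁻¹ deg<5))
    where
    W : Fin N → Bool
    W = compAdj G v
    w : ℕ
    w = count W

    lowDegree⇒⊥ : deg G v ≤ 4 → ⊥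
    lowDegree⇒⊥ deg≤4 = w*30≰w*[w∸1] (≤-trans (s≤s z≤n) 6+n≤w) w≤30 30w≤w[w∸1]
      where
      open ≤-Reasoning
      6+n≤w : 6 + n ≤ w
      6+n≤w = +-cancelʳ-≤ 5 (6 + n) w (begin
        6 + n + 5        ≡⟨ +-comm (6 + n) 5 ⟩
        11 + n           ≡⟨ deg-complement G v ⟨
        w + deg G v + 1  ≤⟨ +-monoˡ-≤ 1 (+-monoʳ-≤ w deg≤4) ⟩
        w + 4 + 1        ≡⟨ +-assoc w 4 1 ⟩
        w + 5            ∎)
      w≤30 : w ≤ 30
      w≤30 = +-cancelʳ-≤ 1 w 30 (begin
        w + 1            ≤⟨ +-monoˡ-≤ 1 (m≤m+n w (deg G v)) ⟩
        w + deg G v + 1  ≡⟨ deg-complement G v ⟩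
        11 + n           ≤⟨ +-monoʳ-≤ 11 n≤20 ⟩
        31               ∎)
      6≤degIn : ∀ x → W x ≡ true → 6 ≤ degIn G W x
      6≤degIn x v≁x = +-cancelʳ-≤ n 6 (degIn G W x) (begin
        6 + n                                             ≤⟨ 6+n≤w ⟩
        w                                                 ≡⟨ count-split G W x ⟩
        codeg (complement G) v x + degIn G W x + ⟦ W x ⟧
          ≡⟨ cong (λ e → codeg (complement G) v x + degIn G W x + ⟦ e ⟧) v≁x ⟩
        codeg (complement G) v x + degIn G W x + 1        ≡⟨ +-comm _ 1 ⟩
        suc (codeg (complement G) v x + degIn G W x)      ≤⟨ +-monoˡ-≤ (degIn G W x) (codeg̅<n v x v≁x) ⟩
        n + degIn G W x                                   ≡⟨ +-comm n _ ⟩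
        degIn G W x + n                                   ∎)
      30w≤w[w∸1] : w * 30 ≤ w * (w ∸ 1)
      30w≤w[w∸1] = begin
        w * 30                                        ≡⟨ ∑-⟦⟧* W 30 ⟨
        ∑[ x < N ] (⟦ W x ⟧ * 30)                     ≤⟨ ∑-mono-≤ pointwise ⟩
        ∑[ x < N ] (degIn G W x * (degIn G W x ∸ 1))  ≤⟨ cherries≤pairs G codeg≤1 W ⟩
        w * (w ∸ 1)                                   ∎
        where
        pointwise : ∀ x → ⟦ W x ⟧ * 30 ≤ degIn G W x * (degIn G W x ∸ 1)
        pointwise x with W x in v≁x
        ... | false = z≤n
        ... | true  = 6≤d⇒30≤d*[d∸1] (6≤degIn x v≁x)

  S : Fin N → Bool
  S x = deg G x ≡ᵇ 5

  s : ℕ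
  s = count S

  S⇒deg≡5 : ∀ {x} → S x ≡ true → deg G x ≡ 5
  S⇒deg≡5 {x} Sx = ≡ᵇ⇒≡ (deg G x) 5 (subst T (sym Sx) _)

  S-nonadjacent⇒codeg≡0 : ∀ {a b} → S a ≡ true → S b ≡ true → compAdj G a b ≡ true → codeg G a b ≡ 0
  S-nonadjacent⇒codeg≡0 {a} {b} Sa Sb a≁b = n≤0⇒n≡0 (+-cancelˡ-≤ (11 + n) (codeg G a b) 0 (begin
    11 + n + codeg G a b       ≡⟨ codeg-complement G a≁b ⟨
    c̄ + deg G a + deg G b + 2  ≡⟨ cong₂ (λ p q → c̄ + p + q + 2) (S⇒deg≡5 Sa) (S⇒deg≡5 Sb) ⟩
    c̄ + 5 + 5 + 2              ≡⟨ rearrange c̄ ⟩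
    suc c̄ + 11                 ≤⟨ +-monoˡ-≤ 11 (codeg̅<n a b a≁b) ⟩
    n + 11                     ≡⟨ +-comm n 11 ⟩
    11 + n                     ≡⟨ +-identityʳ _ ⟨
    11 + n + 0                 ∎))
    where
    open ≤-Reasoning
    c̄ : ℕ
    c̄ = codeg (complement G) a b
    rearrange : ∀ c → c + 5 + 5 + 2 ≡ suc c + 11
    rearrange = solve-∀

  R : Fin N → Fin N → Bool
  R a b = S a ∧ (S ∩ compAdj G a) b

  codeg+R≤1 : ∀ a b → a ≢ b → codeg G a b + ⟦ R a b ⟧ ≤ 1
  codeg+R≤1 a b a≢b with R a b in Rab
  ... | false = subst (_≤ 1) (sym (+-identityʳ _)) (codeg≤1 a b a≢b)
  ... | true  with ∧-true {S a} Rab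
  ...   | Sa , Sb∧a≁b with ∧-true {S b} Sb∧a≁b
  ...     | Sb , a≁b = subst (λ c → c + 1 ≤ 1) (sym (S-nonadjacent⇒codeg≡0 Sa Sb a≁b)) ≤-refl

  cherryCount cherryCountInS nonadjacentPairsInS adjacentPairsInS : ℕ
  cherryCount         = ∑[ x < N ] (deg G x * (deg G x ∸ 1))
  cherryCountInS      = ∑[ x < N ] (degIn G S x * (degIn G S x ∸ 1))
  nonadjacentPairsInS = ∑[ a < N ] (⟦ S a ⟧ * count (S ∩ compAdj G a))
  adjacentPairsInS    = ∑[ a < N ] (⟦ S a ⟧ * degIn G S a)

  30N≤cherries+10s : n ≤ 20 → 30 * N ≤ cherryCount + 10 * s
  30N≤cherries+10s n≤20 = begin
    30 * N                                              ≡⟨ trans (*-comm 30 N) (sym (∑-const N 30)) ⟩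
    ∑[ x < N ] 30
      ≤⟨ ∑-mono-≤ (λ x → 5≤d⇒30≤d*[d∸1]+10*[d≡5] {deg G x} (minDegree n≤20 x)) ⟩
    ∑[ x < N ] (deg G x * (deg G x ∸ 1) + 10 * ⟦ S x ⟧)
      ≡⟨ ∑-distrib-+ (λ x → deg G x * (deg G x ∸ 1)) (λ x → 10 * ⟦ S x ⟧) ⟩
    cherryCount + ∑[ x < N ] (10 * ⟦ S x ⟧)
      ≡⟨ cong (cherryCount +_) (*-distribˡ-sum 10 (λ x → ⟦ S x ⟧)) ⟨
    cherryCount + 10 * s                                ∎
    where open ≤-Reasoning

  cherries+nonadjacent≤ : cherryCount + nonadjacentPairsInS ≤ N * (N ∸ 1)
  cherries+nonadjacent≤ =
    subst₂ (λ p m → cherryCount + p ≤ m) (sum-cong-≗ row) (cong (λ m → m * (m ∸ 1)) (count-true N))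
      (cherries+R≤pairs G R codeg+R≤1 (λ _ → true))
    where
    pointwise : ∀ a b → ⟦ not (does (a ≟ b)) ⟧ * ⟦ R a b ⟧ ≡ ⟦ S a ⟧ * ⟦ (S ∩ compAdj G a) b ⟧
    pointwise a b with a ≟ b
    ... | no _     = trans (*-identityˡ _) (⟦∧⟧ (S a) _)
    ... | yes refl with S a
    ...   | true  = refl
    ...   | false = refl
    row : ∀ a → ∑[ b < N ] (⟦ not (does (a ≟ b)) ⟧ * ⟦ R a b ⟧) ≡ ⟦ S a ⟧ * count (S ∩ compAdj G a)
    row a = trans (sum-cong-≗ (pointwise a)) (sym (*-distribˡ-sum ⟦ S a ⟧ (λ b → ⟦ (S ∩ compAdj G a) b ⟧)))

  nonadjacent+adjacent≡ : nonadjacentPairsInS + adjacentPairsInS ≡ s * (s ∸ 1)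
  nonadjacent+adjacent≡ = begin
    nonadjacentPairsInS + adjacentPairsInS
      ≡⟨ ∑-distrib-+ (λ a → ⟦ S a ⟧ * count (S ∩ compAdj G a)) (λ a → ⟦ S a ⟧ * degIn G S a) ⟨
    ∑[ a < N ] (⟦ S a ⟧ * count (S ∩ compAdj G a) + ⟦ S a ⟧ * degIn G S a)
      ≡⟨ sum-cong-≗ pointwise ⟩
    ∑[ a < N ] (⟦ S a ⟧ * (s ∸ 1))
      ≡⟨ ∑-⟦⟧* S (s ∸ 1) ⟩
    s * (s ∸ 1) ∎
    where
    open ≡-Reasoning
    pointwise : ∀ a → ⟦ S a ⟧ * count (S ∩ compAdj G a) + ⟦ S a ⟧ * degIn G S a ≡ ⟦ S a ⟧ * (s ∸ 1)
    pointwise a with S a in Sa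
    ... | false = refl
    ... | true  = begin
      1 * c + 1 * d        ≡⟨ cong₂ _+_ (*-identityˡ c) (*-identityˡ d) ⟩
      c + d                ≡⟨ m+n∸n≡m (c + d) 1 ⟨
      c + d + 1 ∸ 1        ≡⟨ cong (λ e → c + d + ⟦ e ⟧ ∸ 1) Sa ⟨
      c + d + ⟦ S a ⟧ ∸ 1  ≡⟨ cong (_∸ 1) (count-split G S a) ⟨
      s ∸ 1                ≡⟨ *-identityˡ (s ∸ 1) ⟨
      1 * (s ∸ 1)          ∎
      where
      c d : ℕ
      c = count (S ∩ compAdj G a)
      d = degIn G S a

  4*adjacent≤ : 4 * adjacentPairsInS ≤ cherryCountInS + 6 * s
  4*adjacent≤ = begin
    4 * adjacentPairsInS
      ≡⟨ *-distribˡ-sum 4 (λ a → ⟦ S a ⟧ * degIn G S a) ⟩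
    ∑[ a < N ] (4 * (⟦ S a ⟧ * degIn G S a))
      ≤⟨ ∑-mono-≤ pointwise ⟩
    ∑[ a < N ] (degIn G S a * (degIn G S a ∸ 1) + 6 * ⟦ S a ⟧)
      ≡⟨ ∑-distrib-+ (λ a → degIn G S a * (degIn G S a ∸ 1)) (λ a → 6 * ⟦ S a ⟧) ⟩
    cherryCountInS + ∑[ a < N ] (6 * ⟦ S a ⟧)
      ≡⟨ cong (cherryCountInS +_) (*-distribˡ-sum 6 (λ a → ⟦ S a ⟧)) ⟨
    cherryCountInS + 6 * s ∎
    where
    open ≤-Reasoning
    pointwise : ∀ a → 4 * (⟦ S a ⟧ * degIn G S a) ≤ degIn G S a * (degIn G S a ∸ 1) + 6 * ⟦ S a ⟧
    pointwise a with S a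
    ... | false = z≤n
    ... | true  = subst (λ t → 4 * t ≤ degIn G S a * (degIn G S a ∸ 1) + 6) (sym (*-identityˡ (degIn G S a)))
                        (4*d≤d*[d∸1]+6 (degIn G S a))

  noSuchGraph : n ≤ 20 → CountingInequalityFails N → ⊥
  noSuchGraph n≤20 fails = <⇒≱ (fails (s≤s (count-≤ S)))
    (counting-inequality {N} {s} {cherryCount} {nonadjacentPairsInS} {adjacentPairsInS} {cherryCountInS}
      (30N≤cherries+10s n≤20) cherries+nonadjacent≤ nonadjacent+adjacent≡ 4*adjacent≤
      (cherries≤pairs G codeg≤1 S))

upperBound : ∀ {n} → n ≤ 20 → CountingInequalityFails (11 + n) → RamseyProperty C₄ (Book n) (11 + n)
upperBound {n} n≤20 fails G = decide (C₄⊆ᴳ? G) (Book⊆ᴳ? (complement G) n)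
  where
  decide : Dec (C₄ ⊆ᴳ G) → Dec (Book n ⊆ᴳ complement G) → (C₄ ⊆ᴳ G) ⊎ (Book n ⊆ᴳ complement G)
  decide (yes C₄⊆G) _         = inj₁ C₄⊆G
  decide (no _)     (yes B⊆Ḡ) = inj₂ B⊆Ḡ
  decide (no C₄⊈G)  (no B⊈Ḡ)  = ⊥-elim (UpperBound.noSuchGraph G codeg≤1 codeg̅<n n≤20 fails)
    where
    codeg≤1 : ∀ a b → a ≢ b → codeg G a b ≤ 1
    codeg≤1 a b a≢b =
      s≤s⁻¹ (≰⇒> λ 2≤codeg → C₄⊈G (codeg≥2⇒C₄⊆ᴳ G (a , b , a≢b , 2≤codeg)))
    codeg̅<n : ∀ u v → compAdj G u v ≡ true → codeg (complement G) u v < n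
    codeg̅<n u v u≁v =
      ≰⇒> λ n≤codeg → B⊈Ḡ (codeg≥⇒Book⊆ᴳ (complement G) (u , v , u≁v , n≤codeg))

-- The lower bound

induced : ∀ {M K} → Graph K → (Fin M → Fin K) → Graph M
induced G f = record
  { adj     = λ i j → adj G (f i) (f j)
  ; adj-sym = λ i j → adj-sym G (f i) (f j)
  ; adj-irr = adj-irr G ∘ f
  }

module _ {M K} (G : Graph K) {f : Fin M → Fin K} (f-inj : Injective _≡_ _≡_ f) where

  induced-⊆ᴳ : induced G f ⊆ᴳ G
  induced-⊆ᴳ = f , f-inj , λ _ _ → id

  complement-induced-⊆ᴳ : complement (induced G f) ⊆ᴳ complement G
  complement-induced-⊆ᴳ = f , f-inj , edges
    where
    edges : ∀ i j → compAdj (induced G f) i j ≡ true → compAdj G (f i) (f j) ≡ true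
    edges i j e with i ≟ j | f i ≟ f j
    ... | no _   | no _      = e
    ... | no i≢j | yes fi≡fj = ⊥-elim (i≢j (f-inj fi≡fj))

⊆ᴳ-trans : ∀ {k m n} {H : Graph k} {G : Graph m} {F : Graph n} → H ⊆ᴳ G → G ⊆ᴳ F → H ⊆ᴳ F
⊆ᴳ-trans (f , f-inj , f-edges) (g , g-inj , g-edges) =
  g ∘ f , f-inj ∘ g-inj , λ a b → g-edges (f a) (f b) ∘ f-edges a b

RamseyProperty-mono : ∀ {k l M K} {H₁ : Graph k} {H₂ : Graph l} → M ≤ K →
  RamseyProperty H₁ H₂ M → RamseyProperty H₁ H₂ K
RamseyProperty-mono {M = M} {K} {H₁} {H₂} M≤K ramsey G =
  Sum.map (λ H₁⊆ → ⊆ᴳ-trans {H = H₁} {induced G ι} {G} H₁⊆ (induced-⊆ᴳ G ι-inj))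
          (λ H₂⊆ → ⊆ᴳ-trans {H = H₂} {complement (induced G ι)} {complement G} H₂⊆
                             (complement-induced-⊆ᴳ G ι-inj))
          (ramsey (induced G ι))
  where
  ι : Fin M → Fin K
  ι i = inject≤ i M≤K
  ι-inj : Injective _≡_ _≡_ ι
  ι-inj {i} {j} = inject≤-injective M≤K M≤K i j

lowerBound : ∀ {k l K} {H₁ : Graph k} {H₂ : Graph l} (G : Graph K) →
  ¬ H₁ ⊆ᴳ G → ¬ H₂ ⊆ᴳ complement G → ∀ M → M < suc K → ¬ RamseyProperty H₁ H₂ M
lowerBound {H₁ = H₁} {H₂} G H₁⊈G H₂⊈Ḡ M M≤K ramsey =
  Sum.[ H₁⊈G , H₂⊈Ḡ ] (RamseyProperty-mono {H₁ = H₁} {H₂} (s≤s⁻¹ M≤K) ramsey G)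

-- Row i lists the neighbours of vertex i.
listGraph : ∀ {n} (ns : Vec (List ℕ) n) →
  let listAdj : Fin n → Fin n → Bool
      listAdj i j = any (toℕ j ≡ᵇ_) (lookup ns i)
  in {True (all? λ i → all? λ j → listAdj i j Bool.≟ listAdj j i)} →
     {True (all? λ i → listAdj i i Bool.≟ false)} → Graph n
listGraph ns {symmetric} {irreflexive} = record
  { adj     = λ i j → any (toℕ j ≡ᵇ_) (lookup ns i)
  ; adj-sym = toWitness symmetric
  ; adj-irr = toWitness irreflexive
  }

module _ where
  open import Data.List using ([]; _∷_)
  open import Data.Vec using ([]; _∷_)

  G₂₆ : Graph 26
  G₂₆ = listGraph
    ( (3 ∷ 8 ∷ 13 ∷ 18 ∷ 23 ∷ 24 ∷ [])
    ∷ (6 ∷ 11 ∷ 16 ∷ 21 ∷ 24 ∷ [])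
    ∷ (7 ∷ 12 ∷ 17 ∷ 22 ∷ 24 ∷ [])
    ∷ (0 ∷ 5 ∷ 10 ∷ 15 ∷ 20 ∷ 24 ∷ [])
    ∷ (19 ∷ 20 ∷ 21 ∷ 22 ∷ 23 ∷ 25 ∷ [])
    ∷ (3 ∷ 7 ∷ 11 ∷ 15 ∷ 19 ∷ [])
    ∷ (1 ∷ 8 ∷ 10 ∷ 17 ∷ 19 ∷ [])
    ∷ (2 ∷ 5 ∷ 13 ∷ 16 ∷ 19 ∷ [])
    ∷ (0 ∷ 6 ∷ 12 ∷ 18 ∷ 19 ∷ [])
    ∷ (10 ∷ 11 ∷ 12 ∷ 13 ∷ 25 ∷ [])
    ∷ (3 ∷ 6 ∷ 9 ∷ 17 ∷ 20 ∷ [])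
    ∷ (1 ∷ 5 ∷ 9 ∷ 18 ∷ 22 ∷ [])
    ∷ (2 ∷ 8 ∷ 9 ∷ 15 ∷ 21 ∷ [])
    ∷ (0 ∷ 7 ∷ 9 ∷ 16 ∷ 23 ∷ [])
    ∷ (15 ∷ 16 ∷ 17 ∷ 18 ∷ 25 ∷ [])
    ∷ (3 ∷ 5 ∷ 12 ∷ 14 ∷ 21 ∷ [])
    ∷ (1 ∷ 7 ∷ 13 ∷ 14 ∷ 20 ∷ [])
    ∷ (2 ∷ 6 ∷ 10 ∷ 14 ∷ 23 ∷ [])
    ∷ (0 ∷ 8 ∷ 11 ∷ 14 ∷ 22 ∷ [])
    ∷ (4 ∷ 5 ∷ 6 ∷ 7 ∷ 8 ∷ 25 ∷ [])
    ∷ (3 ∷ 4 ∷ 10 ∷ 16 ∷ 22 ∷ [])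
    ∷ (1 ∷ 4 ∷ 12 ∷ 15 ∷ 23 ∷ [])
    ∷ (2 ∷ 4 ∷ 11 ∷ 18 ∷ 20 ∷ [])
    ∷ (0 ∷ 4 ∷ 13 ∷ 17 ∷ 21 ∷ [])
    ∷ (0 ∷ 1 ∷ 2 ∷ 3 ∷ 25 ∷ [])
    ∷ (4 ∷ 9 ∷ 14 ∷ 19 ∷ 24 ∷ [])
    ∷ [])

  G₂₈ : Graph 28
  G₂₈ = listGraph
    ( (3 ∷ 8 ∷ 13 ∷ 18 ∷ 23 ∷ 24 ∷ [])
    ∷ (6 ∷ 11 ∷ 16 ∷ 21 ∷ 24 ∷ [])
    ∷ (7 ∷ 12 ∷ 17 ∷ 22 ∷ 24 ∷ [])
    ∷ (0 ∷ 5 ∷ 10 ∷ 15 ∷ 20 ∷ 24 ∷ [])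
    ∷ (19 ∷ 20 ∷ 21 ∷ 22 ∷ 23 ∷ 27 ∷ [])
    ∷ (3 ∷ 7 ∷ 11 ∷ 15 ∷ 19 ∷ 26 ∷ [])
    ∷ (1 ∷ 8 ∷ 10 ∷ 17 ∷ 19 ∷ [])
    ∷ (2 ∷ 5 ∷ 13 ∷ 16 ∷ 19 ∷ [])
    ∷ (0 ∷ 6 ∷ 12 ∷ 18 ∷ 19 ∷ 25 ∷ [])
    ∷ (10 ∷ 11 ∷ 12 ∷ 13 ∷ 27 ∷ [])
    ∷ (3 ∷ 6 ∷ 9 ∷ 17 ∷ 20 ∷ [])
    ∷ (1 ∷ 5 ∷ 9 ∷ 18 ∷ 22 ∷ 26 ∷ [])
    ∷ (2 ∷ 8 ∷ 9 ∷ 15 ∷ 21 ∷ 25 ∷ [])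
    ∷ (0 ∷ 7 ∷ 9 ∷ 16 ∷ 23 ∷ [])
    ∷ (15 ∷ 16 ∷ 17 ∷ 18 ∷ 27 ∷ [])
    ∷ (3 ∷ 5 ∷ 12 ∷ 14 ∷ 21 ∷ [])
    ∷ (1 ∷ 7 ∷ 13 ∷ 14 ∷ 20 ∷ 25 ∷ [])
    ∷ (2 ∷ 6 ∷ 10 ∷ 14 ∷ 23 ∷ 26 ∷ [])
    ∷ (0 ∷ 8 ∷ 11 ∷ 14 ∷ 22 ∷ [])
    ∷ (4 ∷ 5 ∷ 6 ∷ 7 ∷ 8 ∷ 27 ∷ [])
    ∷ (3 ∷ 4 ∷ 10 ∷ 16 ∷ 22 ∷ 25 ∷ [])
    ∷ (1 ∷ 4 ∷ 12 ∷ 15 ∷ 23 ∷ [])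
    ∷ (2 ∷ 4 ∷ 11 ∷ 18 ∷ 20 ∷ [])
    ∷ (0 ∷ 4 ∷ 13 ∷ 17 ∷ 21 ∷ 26 ∷ [])
    ∷ (0 ∷ 1 ∷ 2 ∷ 3 ∷ 27 ∷ [])
    ∷ (8 ∷ 12 ∷ 16 ∷ 20 ∷ 26 ∷ [])
    ∷ (5 ∷ 11 ∷ 17 ∷ 23 ∷ 25 ∷ [])
    ∷ (4 ∷ 9 ∷ 14 ∷ 19 ∷ 24 ∷ [])
    ∷ [])

C₄⊈G₂₆ : ¬ C₄ ⊆ᴳ G₂₆
C₄⊈G₂₆ = from-no (C₄⊆ᴳ? G₂₆)

B₁₆⊈Ḡ₂₆ : ¬ Book 16 ⊆ᴳ complement G₂₆
B₁₆⊈Ḡ₂₆ = from-no (Book⊆ᴳ? (complement G₂₆) 16)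

C₄⊈G₂₈ : ¬ C₄ ⊆ᴳ G₂₈
C₄⊈G₂₈ = from-no (C₄⊆ᴳ? G₂₈)

B₁₈⊈Ḡ₂₈ : ¬ Book 18 ⊆ᴳ complement G₂₈
B₁₈⊈Ḡ₂₈ = from-no (Book⊆ᴳ? (complement G₂₈) 18)

corollary2 : IsRamseyNumber C₄ (Book 16) 27 × IsRamseyNumber C₄ (Book 18) 29
corollary2 =
  ( upperBound {16} (m≤m+n 16 4) (from-yes (countingInequalityFails? 27))
  , lowerBound {H₁ = C₄} {Book 16} G₂₆ C₄⊈G₂₆ B₁₆⊈Ḡ₂₆ )
  , ( upperBound {18} (m≤m+n 18 2) (from-yes (countingInequalityFails? 29))
  , lowerBound {H₁ = C₄} {Book 18} G₂₈ C₄⊈G₂₈ B₁₈⊈Ḡ₂₈ )
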